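{- Let $G$ and $H$ be vertex-disjoint graphs such that $G$ is a $(k_1,q_1)$-graph and $H$ is a $(k_2,q_2)$-graph, and let $k=k_1+k_2$ and $q=q_1q_2$. Then there is a connected $(k,q)$-graph $F$; that is, $F$ is connected, $\phi(F)=k_1+k_2=k$, and $I(F;-1)=q_1q_2=I(G\cup H;-1)$, where $G\cup H$ is the disjoint union.
   Context: All graphs are finite and simple. The independence polynomial of $G$ is $I(G;x)=\sum_{j\ge 0} s_j x^j$, where $s_j$ is the number of independent sets of size $j$ in $G$ (with $s_0=1$). The decycling number $\phi(G)$ is the minimum size of a set $S\subseteq V(G)$ with $G-S$ acyclic. A $(k,q)$-graph is a graph $G$ with $\phi(G)=k$ and $I(G;-1)=q$, where $|q|\le 2^k$. -}

module Defs where

open import Data.Nat using (ℕ; zero; suc; _+_; _≤_)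
open import Data.Bool using (Bool; true; false; _∧_; not; if_then_else_)
open import Data.Fin using (Fin; zero; suc; inject₁; fromℕ; splitAt)
open import Data.Fin.Subset using (Subset; inside; outside; _∈_; _∉_; ∣_∣)
open import Data.Vec using (Vec; []; _∷_; lookup)
open import Data.List using (List; []; _∷_; map; _++_; length; filter; allFin; upTo; foldr)
import Data.List as L
open import Data.Nat using (_≡ᵇ_)
open import Data.Integer using (ℤ; +_; -[1+_]) renaming (_+_ to _+ℤ_; _*_ to _*ℤ_; _^_ to _^ℤ_; ∣_∣ to ∣_∣ℤ)
open import Data.Product using (Σ; ∃; _×_; _,_)
open import Data.Sum using (_⊎_; inj₁; inj₂)
open import Relation.Nullary using (¬_)
open import Relation.Binary.PropositionalEquality using (_≡_)
open import Function.Definitions using (Injective)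
open import Data.Sum.Base using ([_,_])

record Graph : Set where
  field
    n      : ℕ
    adj    : Fin n → Fin n → Bool
    sym    : ∀ u v → adj u v ≡ adj v u
    irrefl : ∀ v → adj v v ≡ false
open Graph public

allSubsets : (m : ℕ) → List (Subset m)
allSubsets zero    = [] ∷ []
allSubsets (suc m) = map (inside ∷_) (allSubsets m) ++ map (outside ∷_) (allSubsets m)

allB : {A : Set} → (A → Bool) → List A → Bool
allB p = foldr (λ x b → p x ∧ b) true

isIndependent : (G : Graph) → Subset (n G) → Bool
isIndependent G S =
  allB (λ i → allB (λ j → not (lookup S i ∧ lookup S j ∧ adj G i j)) (allFin (n G))) (allFin (n G))

indepCount : Graph → ℕ → ℕ
indepCount G j = length (filter (λ S → isIndependent G S Data.Bool.∧ (∣ S ∣ ≡ᵇ j) Data.Bool.≟ true)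
                                 (allSubsets (n G)))
  where import Data.Bool

indepPolyAtMinusOne : Graph → ℤ
indepPolyAtMinusOne G =
  foldr _+ℤ_ (+ 0) (map (λ j → (+ indepCount G j) *ℤ (-[1+ 0 ] ^ℤ j)) (upTo (suc (n G))))

record CycleAvoiding (G : Graph) (S : Subset (n G)) : Set where
  field
    len     : ℕ
    vert    : Fin (suc (suc (suc len))) → Fin (n G)
    distinct : Injective _≡_ _≡_ vert
    step    : ∀ (i : Fin (suc (suc len))) → adj G (vert (inject₁ i)) (vert (suc i)) ≡ true
    close   : adj G (vert (fromℕ (suc (suc len)))) (vert zero) ≡ true
    avoid   : ∀ i → vert i ∉ S

IsDecyclingSet : (G : Graph) → Subset (n G) → Set
IsDecyclingSet G S = ¬ CycleAvoiding G S

DecyclingNumberIs : Graph → ℕ → Set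
DecyclingNumberIs G k =
  (Σ (Subset (n G)) λ S → IsDecyclingSet G S × ∣ S ∣ ≡ k)
  × (∀ (S : Subset (n G)) → IsDecyclingSet G S → k ≤ ∣ S ∣)

IsKQGraph : Graph → ℕ → ℤ → Set
IsKQGraph G k q = DecyclingNumberIs G k × indepPolyAtMinusOne G ≡ q × ∣ q ∣ℤ ≤ 2 Data.Nat.^ k
  where import Data.Nat

data Walk (G : Graph) : Fin (n G) → Fin (n G) → Set where
  here : ∀ {u} → Walk G u u
  step : ∀ {u w v} → adj G u w ≡ true → Walk G w v → Walk G u v

Connected : Graph → Set
Connected G = ∀ u v → Walk G u v

unionAdj : (G H : Graph) → Fin (n G + n H) → Fin (n G + n H) → Bool
unionAdj G H u v with splitAt (n G) u | splitAt (n G) v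
... | inj₁ a | inj₁ b = adj G a b
... | inj₂ a | inj₂ b = adj H a b
... | inj₁ _ | inj₂ _ = false
... | inj₂ _ | inj₁ _ = false

unionSym : (G H : Graph) → ∀ u v → unionAdj G H u v ≡ unionAdj G H v u
unionSym G H u v with splitAt (n G) u | splitAt (n G) v
... | inj₁ a | inj₁ b = sym G a b
... | inj₂ a | inj₂ b = sym H a b
... | inj₁ _ | inj₂ _ = Relation.Binary.PropositionalEquality.refl
... | inj₂ _ | inj₁ _ = Relation.Binary.PropositionalEquality.refl

unionIrrefl : (G H : Graph) → ∀ v → unionAdj G H v v ≡ false
unionIrrefl G H v with splitAt (n G) v
... | inj₁ a = irrefl G a
... | inj₂ a = irrefl H a

disjointUnion : Graph → Graph → Graph
disjointUnion G H = record
  { n = n G + n H ; adj = unionAdj G H ; sym = unionSym G H ; irrefl = unionIrrefl G H }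

-- Let K = G ∪ H. Add a hub joined to exactly one vertex of each component of K, and hang two
-- paths of length two at the hub. Since the hub meets each component
-- once, every cycle of F lies in K, so φ(F) = φ(K) = φ(G) + φ(H). At x = -1, a pendant path
-- c – a – b gives I(F) = -I(F - {a, b, c}): each of the two paths contributes a factor -1 and
-- the first one removes the hub, so I(F; -1) = I(K; -1) = I(G; -1) I(H; -1).
module Submission where

import Algebra.Properties.CommutativeSemigroup as CommutativeSemigroupProperties
open import Algebra.Bundles using (CommutativeMonoid)
open import Data.Bool using (Bool; true; false; _∧_; _∨_; not; if_then_else_)
import Data.Bool as Bool
import Data.Bool.Properties as BoolP
open import Data.Empty using (⊥-elim)
open import Data.Fin as Fin using (Fin; zero; suc; toℕ; inject₁; fromℕ; _↑ˡ_; _↑ʳ_)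
open import Data.Fin.Induction using (<-weakInduction; >-weakInduction)
open import Data.Fin.Properties as FinP using (any?)
open import Data.Fin.Relation.Unary.Top using (view; ‵fromℕ; ‵inj₁)
open import Data.Fin.Subset as Subset using (Subset; inside; outside; _∈_; _⊆_; _⊂_; _∪_; ⁅_⁆; ∣_∣)
open import Data.Fin.Subset.Properties
  using (_∈?_; _⊂?_; ⊆-antisym; p⊂q⇒∣p∣<∣q∣; ∣p∣≤n; ∣p∣≤∣x∷p∣; x∈⁅x⁆; x∈⁅y⁆⇒x≡y;
         x∈p∪q⁺; x∈p∪q⁻; p⊆p∪q; ∪-identityˡ; ∪-identityʳ; ∪-idem)
open import Data.Integer as ℤ using (ℤ; +_; -_; -[1+_]; _-_; _*_; _^_) renaming (_+_ to _+ℤ_)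
import Data.Integer.Properties as ℤP
open import Data.Integer.Tactic.RingSolver using (solve-∀)
open import Data.List as L using (List; []; _∷_; foldr; upTo)
import Data.List.Properties as ListP
open import Data.Maybe using (Maybe; just; nothing)
import Data.Maybe.Properties as Maybe
open import Data.Nat as ℕ using (ℕ; zero; suc; _+_; _≡ᵇ_)
import Data.Nat.Properties as ℕP
open import Data.Nat.GeneralisedArithmetic using (fold)
open import Data.Product using (Σ; ∃; ∃₂; _×_; _,_; proj₁; proj₂)
open import Data.Sum as Sum using (_⊎_; inj₁; inj₂)
open import Data.Unit using (tt)
open import Data.Vec as Vec using ([]; _∷_; here; there; lookup; tabulate)
import Data.Vec.Properties as VecP
open import Function using (_∘_)
open import Relation.Binary.Definitions using (tri<; tri≈; tri>)
open import Relation.Binary.PropositionalEquality as ≡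
  using (_≡_; _≢_; ≢-sym; refl; trans; cong; cong₂; subst₂; module ≡-Reasoning)
open import Relation.Nullary using (¬_; Dec; yes; no; does; _×-dec_)
open import Relation.Nullary.Decidable using (dec-true)

open import Defs

private
  module ∧ =
    CommutativeSemigroupProperties (CommutativeMonoid.commutativeSemigroup BoolP.∧-commutativeMonoid)
  module +ℤ = CommutativeSemigroupProperties ℤP.+-commutativeSemigroup

  variable
    K K′ : Graph

adj-flip : ∀ K {u v} → adj K u v ≡ true → adj K v u ≡ true
adj-flip K {u} {v} e = trans (sym K v u) e

_++ᵂ_ : ∀ {u v w} → Walk K u v → Walk K v w → Walk K u w
here     ++ᵂ q = q
step e p ++ᵂ q = step e (p ++ᵂ q)

reverseᵂ : ∀ {u v} → Walk K u v → Walk K v u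
reverseᵂ here       = here
reverseᵂ {K} (step e p) = reverseᵂ p ++ᵂ step (adj-flip K e) here

mapᵂ : (g : Fin (n K) → Fin (n K′)) → (∀ {u v} → adj K u v ≡ true → adj K′ (g u) (g v) ≡ true) →
       ∀ {u v} → Walk K u v → Walk K′ (g u) (g v)
mapᵂ g g-adj here       = here
mapᵂ g g-adj (step e p) = step (g-adj e) (mapᵂ g g-adj p)

open CycleAvoiding renaming (step to cycle-step)

module _ {S : Subset (n K)} {S′ : Subset (n K′)} (g : Fin (n K) → Fin (n K′))
         (g-adj : ∀ u v → adj K′ (g u) (g v) ≡ adj K u v)
         (g-∈ : ∀ u → lookup S′ (g u) ≡ lookup S u) where

  cycle-image : (∀ {u v} → g u ≡ g v → u ≡ v) → CycleAvoiding K S → CycleAvoiding K′ S′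
  cycle-image g-inj C = record
    { len      = len C
    ; vert     = λ i → g (vert C i)
    ; distinct = λ e → distinct C (g-inj e)
    ; step     = λ i → trans (g-adj _ _) (cycle-step C i)
    ; close    = trans (g-adj _ _) (close C)
    ; avoid    = λ i gi∈S′ → avoid C i
        (VecP.lookup⇒[]= _ S (trans (≡.sym (g-∈ (vert C i))) (VecP.[]=⇒lookup gi∈S′)))
    }

  cycle-preimage : (C : CycleAvoiding K′ S′) → (∀ i → ∃ λ u → g u ≡ vert C i) → CycleAvoiding K S
  cycle-preimage C pre = record
    { len      = len C
    ; vert     = vert′
    ; distinct = λ {i} {j} e →
        distinct C (trans (≡.sym (proj₂ (pre i))) (trans (cong g e) (proj₂ (pre j))))
    ; step     = λ i → edge (cycle-step C i)
    ; close    = edge (close C)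
    ; avoid    = λ i i∈S → avoid C i (VecP.lookup⇒[]= _ S′
        (trans (cong (lookup S′) (≡.sym (proj₂ (pre i)))) (trans (g-∈ _) (VecP.[]=⇒lookup i∈S))))
    }
    where
    vert′ : _ → Fin (n K)
    vert′ i = proj₁ (pre i)
    edge : ∀ {i j} → adj K′ (vert C i) (vert C j) ≡ true → adj K (vert′ i) (vert′ j) ≡ true
    edge {i} {j} e = trans (≡.sym (g-adj _ _))
      (subst₂ (λ x y → adj K′ x y ≡ true) (≡.sym (proj₂ (pre i))) (≡.sym (proj₂ (pre j))) e)

module _ {S : Subset (n K)} (C : CycleAvoiding K S) where

  cycle-neighbours : ∀ i → ∃₂ λ j k → j ≢ k × adj K (vert C i) (vert C j) ≡ true
                                           × adj K (vert C i) (vert C k) ≡ true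
  cycle-neighbours i with view i
  ... | ‵fromℕ = zero , inject₁ (fromℕ (suc (len C))) , (λ ()) , close C
               , adj-flip K (cycle-step C (fromℕ (suc (len C))))
  ... | ‵inj₁ {i = zero} _ = suc zero , fromℕ (suc (suc (len C))) , (λ ()) , cycle-step C zero
                           , adj-flip K (close C)
  ... | ‵inj₁ {i = suc p} _ = suc (suc p) , inject₁ (inject₁ p) , ≢-sym (FinP.<⇒≢ inject₁²<2+)
                            , cycle-step C (suc p) , adj-flip K (cycle-step C (inject₁ p))
    where
    inject₁²<2+ : inject₁ (inject₁ p) Fin.< suc (suc p)
    inject₁²<2+ rewrite FinP.toℕ-inject₁ (inject₁ p) | FinP.toℕ-inject₁ p =
      ℕP.m<n⇒m<1+n (ℕP.n<1+n _)

module _ {A : Set} {L : ℕ} (ℓ : Fin (suc L) → A) (i : Fin (suc L))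
         (ℓ-step  : ∀ p → inject₁ p ≢ i → suc p ≢ i → ℓ (inject₁ p) ≡ ℓ (suc p))
         (ℓ-close : fromℕ L ≢ i → zero ≢ i → ℓ (fromℕ L) ≡ ℓ zero) where

  private
    below : ∀ j → j Fin.< i → ℓ j ≡ ℓ zero
    below = <-weakInduction (λ j → j Fin.< i → ℓ j ≡ ℓ zero) (λ _ → refl) λ p ih 1+p<i →
      let p<i = FinP.ℕ<⇒inject₁< (ℕP.<⇒≤ 1+p<i)
      in trans (≡.sym (ℓ-step p (FinP.<⇒≢ p<i) (FinP.<⇒≢ 1+p<i))) (ih p<i)

    above : ∀ j → i Fin.< j → ℓ j ≡ ℓ (fromℕ L)
    above = >-weakInduction (λ j → i Fin.< j → ℓ j ≡ ℓ (fromℕ L)) (λ _ → refl) λ p ih i<p →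
      let i<1+p = ℕP.m<n⇒m<1+n (≡.subst (toℕ i ℕ.<_) (FinP.toℕ-inject₁ p) i<p)
      in trans (ℓ-step p (≢-sym (FinP.<⇒≢ i<p)) (≢-sym (FinP.<⇒≢ i<1+p))) (ih i<1+p)

    ends : ∀ {j k : Fin (suc L)} → j Fin.< i → i Fin.< k → ℓ (fromℕ L) ≡ ℓ zero
    ends {j} {k} j<i i<k = ℓ-close
      (λ e → ℕP.<-irrefl refl (ℕP.<-≤-trans (≡.subst (Fin._< k) (≡.sym e) i<k) (FinP.≤fromℕ k)))
      (λ e → ℕP.n≮0 (≡.subst (j Fin.<_) (≡.sym e) j<i))

  cycle-constant : ∀ j k → j ≢ i → k ≢ i → ℓ j ≡ ℓ k
  cycle-constant j k j≢i k≢i with FinP.<-cmp j i | FinP.<-cmp k i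
  ... | tri≈ _ j≡i _ | _            = ⊥-elim (j≢i j≡i)
  ... | _            | tri≈ _ k≡i _ = ⊥-elim (k≢i k≡i)
  ... | tri< j<i _ _ | tri< k<i _ _ = trans (below j j<i) (≡.sym (below k k<i))
  ... | tri> _ _ i<j | tri> _ _ i<k = trans (above j i<j) (≡.sym (above k i<k))
  ... | tri< j<i _ _ | tri> _ _ i<k = trans (below j j<i) (≡.sym (trans (above k i<k) (ends j<i i<k)))
  ... | tri> _ _ i<j | tri< k<i _ _ = trans (above j i<j) (trans (ends k<i i<j) (≡.sym (below k k<i)))

subsetOf : ∀ {m} {P : Fin m → Set} → (∀ x → Dec (P x)) → Subset m
subsetOf P? = tabulate (λ x → does (P? x))

∈-subsetOf⁺ : ∀ {m} {P : Fin m → Set} (P? : ∀ x → Dec (P x)) {x} → P x → x ∈ subsetOf P?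
∈-subsetOf⁺ P? {x} px = VecP.lookup⇒[]= x _ (trans (VecP.lookup∘tabulate _ x) (dec-true (P? x) px))

∈-subsetOf⁻ : ∀ {m} {P : Fin m → Set} (P? : ∀ x → Dec (P x)) {x} → x ∈ subsetOf P? → P x
∈-subsetOf⁻ P? {x} x∈ with P? x | trans (≡.sym (VecP.lookup∘tabulate _ x)) (VecP.[]=⇒lookup x∈)
... | yes px | _ = px

⊆-⊄⇒≡ : ∀ {m} {P Q : Subset m} → P ⊆ Q → ¬ P ⊂ Q → P ≡ Q
⊆-⊄⇒≡ {P = P} {Q} P⊆Q P⊄Q = ⊆-antisym P⊆Q Q⊆P
  where
  Q⊆P : Q ⊆ P
  Q⊆P {x} x∈Q with x ∈? P
  ... | yes x∈P = x∈P
  ... | no  x∉P = ⊥-elim (P⊄Q (P⊆Q , x , x∈Q , x∉P))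

module _ {m} (f : Subset m → Subset m) (f-inflationary : ∀ P → P ⊆ f P) where

  fold-⊇ : ∀ P t → P ⊆ fold P f t
  fold-⊇ P zero    = λ x∈P → x∈P
  fold-⊇ P (suc t) = λ x∈P → f-inflationary _ (fold-⊇ P t x∈P)

  -- Until the iterates stabilise, each step adds an element, and only m are available.
  private
    stable-or-large : ∀ P t → f (fold P f t) ≡ fold P f t ⊎ t ℕ.≤ ∣ fold P f t ∣
    stable-or-large P zero = inj₂ ℕ.z≤n
    stable-or-large P (suc t) with stable-or-large P t
    ... | inj₁ fixed = inj₁ (cong f fixed)
    ... | inj₂ t≤∣Pₜ∣ with fold P f t ⊂? f (fold P f t)
    ...   | yes Pₜ⊂Pₜ₊₁ = inj₂ (ℕP.≤-<-trans t≤∣Pₜ∣ (p⊂q⇒∣p∣<∣q∣ Pₜ⊂Pₜ₊₁))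
    ...   | no  Pₜ⊄Pₜ₊₁ = inj₁ (cong f (≡.sym (⊆-⊄⇒≡ (f-inflationary _) Pₜ⊄Pₜ₊₁)))

  fold-fixedPoint : ∀ P → f (fold P f (suc m)) ≡ fold P f (suc m)
  fold-fixedPoint P with stable-or-large P (suc m)
  ... | inj₁ fixed = fixed
  ... | inj₂ large = ⊥-elim (ℕP.<-irrefl refl (ℕP.≤-trans large (∣p∣≤n (fold P f (suc m)))))

least : ∀ {m} (P : Subset m) {x} → x ∈ P → Fin m
least (inside  ∷ P) _           = zero
least (outside ∷ P) (there x∈P) = suc (least P x∈P)

least-∈ : ∀ {m} {P : Subset m} {x} (x∈P : x ∈ P) → least P x∈P ∈ P
least-∈ {P = inside  ∷ P} _           = here
least-∈ {P = outside ∷ P} (there x∈P) = there (least-∈ x∈P)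

least-cong : ∀ {m} {P Q : Subset m} {x y} → P ≡ Q → (x∈P : x ∈ P) (y∈Q : y ∈ Q) →
             least P x∈P ≡ least Q y∈Q
least-cong {P = inside  ∷ P} refl _           _           = refl
least-cong {P = outside ∷ P} refl (there x∈P) (there y∈P) = cong suc (least-cong refl x∈P y∈P)

-- Connected components

module Components (K : Graph) where

  adjacent-from? : ∀ P w → Dec (∃ λ v → v ∈ P × adj K v w ≡ true)
  adjacent-from? P w = any? λ v → v ∈? P ×-dec adj K v w Bool.≟ true

  expand : Subset (n K) → Subset (n K)
  expand P = P ∪ subsetOf (adjacent-from? P)

  private
    expand-⊇ : ∀ P → P ⊆ expand P
    expand-⊇ P = p⊆p∪q _

    expand-⁻ : ∀ {P w} → w ∈ expand P → w ∈ P ⊎ ∃ λ v → v ∈ P × adj K v w ≡ true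
    expand-⁻ {P} w∈ = Sum.map₂ (∈-subsetOf⁻ (adjacent-from? P)) (x∈p∪q⁻ P _ w∈)

    expand-⁺ : ∀ {P v w} → v ∈ P → adj K v w ≡ true → w ∈ expand P
    expand-⁺ {P} v∈P e = x∈p∪q⁺ (inj₂ (∈-subsetOf⁺ (adjacent-from? P) (_ , v∈P , e)))

    fold-sound : ∀ {u w} t → w ∈ fold ⁅ u ⁆ expand t → Walk K u w
    fold-sound {u} zero w∈ = ≡.subst (Walk K u) (≡.sym (x∈⁅y⁆⇒x≡y u w∈)) here
    fold-sound (suc t) w∈ with expand-⁻ w∈
    ... | inj₁ w∈Pₜ           = fold-sound t w∈Pₜ
    ... | inj₂ (v , v∈Pₜ , e) = fold-sound t v∈Pₜ ++ᵂ step e here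

  reachable : Fin (n K) → Subset (n K)
  reachable u = fold ⁅ u ⁆ expand (suc (n K))

  reachable-sound : ∀ {u w} → w ∈ reachable u → Walk K u w
  reachable-sound = fold-sound (suc (n K))

  reachable-complete : ∀ {u w} → Walk K u w → w ∈ reachable u
  reachable-complete {u} = go (fold-⊇ expand expand-⊇ ⁅ u ⁆ (suc (n K)) (x∈⁅x⁆ u))
    where
    go : ∀ {v w} → v ∈ reachable u → Walk K v w → w ∈ reachable u
    go v∈ here       = v∈
    go v∈ (step e p) =
      go (≡.subst (_ ∈_) (fold-fixedPoint expand expand-⊇ ⁅ u ⁆) (expand-⁺ v∈ e)) p

  reachable-cong : ∀ {u v} → Walk K u v → reachable u ≡ reachable v
  reachable-cong p = ⊆-antisym
    (λ w∈ → reachable-complete (reverseᵂ p ++ᵂ reachable-sound w∈))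
    (λ w∈ → reachable-complete (p ++ᵂ reachable-sound w∈))

  representative : Fin (n K) → Fin (n K)
  representative u = least (reachable u) (reachable-complete (here {u = u}))

  walk-to-representative : ∀ u → Walk K u (representative u)
  walk-to-representative u = reachable-sound (least-∈ _)

  representative-cong : ∀ {u v} → Walk K u v → representative u ≡ representative v
  representative-cong p = least-cong (reachable-cong p) _ _

  representatives : Subset (n K)
  representatives = subsetOf λ u → representative u Fin.≟ u

  representative-∈ : ∀ u → representative u ∈ representatives
  representative-∈ u = ∈-subsetOf⁺ (λ u → representative u Fin.≟ u)
    (representative-cong (reverseᵂ (walk-to-representative u)))

  ∈-representatives : ∀ {r} → r ∈ representatives → representative r ≡ r
  ∈-representatives = ∈-subsetOf⁻ (λ u → representative u Fin.≟ u)

sumOver : {A : Set} → List A → (A → ℤ) → ℤ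
sumOver xs f = foldr _+ℤ_ (+ 0) (L.map f xs)

module _ {A : Set} where

  sumOver-cong : ∀ (xs : List A) {f g : A → ℤ} → (∀ x → f x ≡ g x) → sumOver xs f ≡ sumOver xs g
  sumOver-cong xs f≗g = cong (foldr _+ℤ_ (+ 0)) (ListP.map-cong f≗g xs)

  sumOver-0 : ∀ (xs : List A) → sumOver xs (λ _ → + 0) ≡ + 0
  sumOver-0 []       = refl
  sumOver-0 (x ∷ xs) = trans (ℤP.+-identityˡ _) (sumOver-0 xs)

  sumOver-+ : ∀ (xs : List A) (f g : A → ℤ) →
              sumOver xs (λ x → f x +ℤ g x) ≡ sumOver xs f +ℤ sumOver xs g
  sumOver-+ []       f g = refl
  sumOver-+ (x ∷ xs) f g = trans (cong (f x +ℤ g x +ℤ_) (sumOver-+ xs f g))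
                                 (+ℤ.interchange (f x) (g x) (sumOver xs f) (sumOver xs g))

  sumOver-neg : ∀ (xs : List A) (f : A → ℤ) → sumOver xs (λ x → - f x) ≡ - sumOver xs f
  sumOver-neg []       f = refl
  sumOver-neg (x ∷ xs) f = trans (cong (- f x +ℤ_) (sumOver-neg xs f)) (≡.sym (ℤP.neg-distrib-+ (f x) _))

  sumOver-++ : ∀ (xs ys : List A) f → sumOver (xs L.++ ys) f ≡ sumOver xs f +ℤ sumOver ys f
  sumOver-++ []       ys f = ≡.sym (ℤP.+-identityˡ _)
  sumOver-++ (x ∷ xs) ys f = trans (cong (f x +ℤ_) (sumOver-++ xs ys f)) (≡.sym (ℤP.+-assoc (f x) _ _))

  sumOver-map : ∀ {B : Set} (g : B → A) (xs : List B) f →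
                sumOver (L.map g xs) f ≡ sumOver xs (λ x → f (g x))
  sumOver-map g xs f = cong (foldr _+ℤ_ (+ 0)) (≡.sym (ListP.map-∘ xs))

sumOver-delta : ∀ N {s} (g : ℕ → ℤ) → s ℕ.< N →
                sumOver (upTo N) (λ j → if s ≡ᵇ j then g j else + 0) ≡ g s
sumOver-delta (suc N) {s} g s<1+N = trans (cong (h 0 +ℤ_) shift) (go s s<1+N)
  where
  h : ℕ → ℤ
  h j = if s ≡ᵇ j then g j else + 0
  shift : sumOver (L.applyUpTo suc N) h ≡ sumOver (upTo N) (λ j → h (suc j))
  shift = trans (cong (λ js → sumOver js h) (≡.sym (ListP.map-upTo suc N))) (sumOver-map suc (upTo N) h)
  go : ∀ s → s ℕ.< suc N →
       (if s ≡ᵇ 0 then g 0 else + 0) +ℤ sumOver (upTo N) (λ j → if s ≡ᵇ suc j then g (suc j) else + 0)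
       ≡ g s
  go zero    _           = trans (cong (g 0 +ℤ_) (sumOver-0 (upTo N))) (ℤP.+-identityʳ (g 0))
  go (suc s) (ℕ.s≤s s<N) = trans (ℤP.+-identityˡ _) (sumOver-delta N (λ j → g (suc j)) s<N)

-- The independence polynomial at -1

Adjacency : ℕ → Set
Adjacency m = Fin m → Fin m → Bool

delete₀ : ∀ {m} → Adjacency (suc m) → Adjacency m
delete₀ a u v = a (suc u) (suc v)

neighbours₀ : ∀ {m} → Adjacency (suc m) → Subset m
neighbours₀ a = tabulate (λ v → a zero (suc v))

sign : ℕ → ℤ
sign j = -[1+ 0 ] ^ j

-- The sum of (-1)^|S| over the independent sets S that avoid the forbidden set X.
indepSum : ∀ {m} → Adjacency m → Subset m → ℤ
indepSum {zero}  a []            = + 1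
indepSum {suc m} a (inside  ∷ X) = indepSum (delete₀ a) X
indepSum {suc m} a (outside ∷ X) = indepSum (delete₀ a) X - indepSum (delete₀ a) (X ∪ neighbours₀ a)

disjoint : ∀ {m} → Subset m → Subset m → Bool
disjoint []      []      = true
disjoint (s ∷ S) (x ∷ X) = not (s ∧ x) ∧ disjoint S X

isIndep : ∀ {m} → Adjacency m → Subset m → Bool
isIndep a []            = true
isIndep a (inside  ∷ S) = disjoint S (neighbours₀ a) ∧ isIndep (delete₀ a) S
isIndep a (outside ∷ S) = isIndep (delete₀ a) S

disjoint-∪ : ∀ {m} (S X Y : Subset m) → disjoint S (X ∪ Y) ≡ disjoint S X ∧ disjoint S Y
disjoint-∪ []            []      []      = refl
disjoint-∪ (outside ∷ S) (x ∷ X) (y ∷ Y) = disjoint-∪ S X Y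
disjoint-∪ (inside  ∷ S) (true  ∷ X) (y     ∷ Y) = refl
disjoint-∪ (inside  ∷ S) (false ∷ X) (true  ∷ Y) = ≡.sym (BoolP.∧-zeroʳ (disjoint S X))
disjoint-∪ (inside  ∷ S) (false ∷ X) (false ∷ Y) = disjoint-∪ S X Y

disjoint-⊥ : ∀ {m} (S : Subset m) → disjoint S Subset.⊥ ≡ true
disjoint-⊥ []      = refl
disjoint-⊥ (s ∷ S) = trans (cong (not (s ∧ false) ∧_) (disjoint-⊥ S))
                           (trans (BoolP.∧-identityʳ _) (cong not (BoolP.∧-zeroʳ s)))

sumOver-allSubsets : ∀ {m} (f : Subset (suc m) → ℤ) →
  sumOver (allSubsets (suc m)) f
  ≡ sumOver (allSubsets m) (λ S → f (inside ∷ S)) +ℤ sumOver (allSubsets m) (λ S → f (outside ∷ S))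
sumOver-allSubsets {m} f = trans (sumOver-++ (L.map (inside ∷_) (allSubsets m)) _ f)
  (cong₂ _+ℤ_ (sumOver-map (inside ∷_) (allSubsets m) f) (sumOver-map (outside ∷_) (allSubsets m) f))

indepTerm : ∀ {m} → Adjacency m → Subset m → Subset m → ℤ
indepTerm a X S = if isIndep a S ∧ disjoint S X then sign ∣ S ∣ else + 0

indepSum-sumOver : ∀ {m} (a : Adjacency m) X → indepSum a X ≡ sumOver (allSubsets m) (indepTerm a X)
indepSum-sumOver {zero} a [] = refl
indepSum-sumOver {suc m} a (inside ∷ X) = ≡.sym (begin
  sumOver (allSubsets (suc m)) (indepTerm a (inside ∷ X))
    ≡⟨ sumOver-allSubsets (indepTerm a (inside ∷ X)) ⟩
  sumOver (allSubsets m) (λ S → indepTerm a (inside ∷ X) (inside ∷ S))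
    +ℤ sumOver (allSubsets m) (indepTerm (delete₀ a) X)
    ≡⟨ cong₂ _+ℤ_ (trans (sumOver-cong (allSubsets m) forbidden) (sumOver-0 (allSubsets m)))
                  (≡.sym (indepSum-sumOver (delete₀ a) X)) ⟩
  + 0 +ℤ indepSum (delete₀ a) X                                    ≡⟨ ℤP.+-identityˡ _ ⟩
  indepSum (delete₀ a) X                                           ∎)
  where
  open ≡-Reasoning
  forbidden : ∀ S → indepTerm a (inside ∷ X) (inside ∷ S) ≡ + 0
  forbidden S = cong (λ b → if b then sign ∣ inside ∷ S ∣ else + 0) (BoolP.∧-zeroʳ _)
indepSum-sumOver {suc m} a (outside ∷ X) = ≡.sym (begin
  sumOver (allSubsets (suc m)) (indepTerm a (outside ∷ X))
    ≡⟨ sumOver-allSubsets (indepTerm a (outside ∷ X)) ⟩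
  sumOver (allSubsets m) (λ S → indepTerm a (outside ∷ X) (inside ∷ S))
    +ℤ sumOver (allSubsets m) (indepTerm (delete₀ a) X)
    ≡⟨ cong₂ _+ℤ_ (trans (sumOver-cong (allSubsets m) chosen) (sumOver-neg (allSubsets m) _))
                  (≡.sym (indepSum-sumOver (delete₀ a) X)) ⟩
  - sumOver (allSubsets m) (indepTerm (delete₀ a) (X ∪ N)) +ℤ indepSum (delete₀ a) X
    ≡⟨ cong (λ z → - z +ℤ indepSum (delete₀ a) X) (≡.sym (indepSum-sumOver (delete₀ a) (X ∪ N))) ⟩
  - indepSum (delete₀ a) (X ∪ N) +ℤ indepSum (delete₀ a) X
    ≡⟨ ℤP.+-comm (- indepSum (delete₀ a) (X ∪ N)) _ ⟩
  indepSum (delete₀ a) X - indepSum (delete₀ a) (X ∪ N)           ∎)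
  where
  open ≡-Reasoning
  N = neighbours₀ a
  if-neg : ∀ b z → (if b then -[1+ 0 ] * z else + 0) ≡ - (if b then z else + 0)
  if-neg true  z = ℤP.-1*i≡-i z
  if-neg false z = refl
  chosen : ∀ S → indepTerm a (outside ∷ X) (inside ∷ S) ≡ - indepTerm (delete₀ a) (X ∪ N) S
  chosen S = trans (cong (λ b → if b then sign (suc ∣ S ∣) else + 0)
                         (trans (∧.xy∙z≈y∙zx (disjoint S N) _ (disjoint S X))
                                (cong (isIndep (delete₀ a) S ∧_) (≡.sym (disjoint-∪ S X N)))))
                   (if-neg _ (sign ∣ S ∣))

allOf : ∀ {k} → (Fin k → Bool) → Bool
allOf {zero}  h = true
allOf {suc k} h = h zero ∧ allOf (λ i → h (suc i))

allB-tabulate : ∀ {A : Set} {k} (p : A → Bool) (f : Fin k → A) →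
                allB p (L.tabulate f) ≡ allOf (λ i → p (f i))
allB-tabulate {k = zero}  p f = refl
allB-tabulate {k = suc k} p f = cong (p (f zero) ∧_) (allB-tabulate p (λ i → f (suc i)))

allOf-cong : ∀ {k} {g h : Fin k → Bool} → (∀ i → g i ≡ h i) → allOf g ≡ allOf h
allOf-cong {zero}  g≗h = refl
allOf-cong {suc k} g≗h = cong₂ _∧_ (g≗h zero) (allOf-cong (λ i → g≗h (suc i)))

allOf-true : ∀ k → allOf {k} (λ _ → true) ≡ true
allOf-true zero    = refl
allOf-true (suc k) = allOf-true k

allOf-∧ : ∀ {k} (g h : Fin k → Bool) → allOf (λ i → g i ∧ h i) ≡ allOf g ∧ allOf h
allOf-∧ {zero}  g h = refl
allOf-∧ {suc k} g h =
  trans (cong ((g zero ∧ h zero) ∧_) (allOf-∧ (g ∘ suc) (h ∘ suc))) (∧.interchange (g zero) (h zero) _ _)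

allOf-disjoint : ∀ {k} (S : Subset k) (h : Fin k → Bool) →
                 allOf (λ j → not (lookup S j ∧ h j)) ≡ disjoint S (tabulate h)
allOf-disjoint []      h = refl
allOf-disjoint (s ∷ S) h = cong (not (s ∧ h zero) ∧_) (allOf-disjoint S (λ j → h (suc j)))

noEdgeWithin : ∀ {m} → Adjacency m → Subset m → Bool
noEdgeWithin a S = allOf λ i → allOf λ j → not (lookup S i ∧ lookup S j ∧ a i j)

noEdgeWithin≡isIndep : ∀ {m} (a : Adjacency m) → (∀ u v → a u v ≡ a v u) → (∀ v → a v v ≡ false) →
                       ∀ S → noEdgeWithin a S ≡ isIndep a S
noEdgeWithin≡isIndep a a-sym a-irr [] = refl
noEdgeWithin≡isIndep {suc m} a a-sym a-irr (s ∷ S) = begin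
  (f zero zero ∧ R) ∧ allOf (λ i → f (suc i) zero ∧ allOf (λ j → f (suc i) (suc j)))
    ≡⟨ cong₂ (λ x y → (x ∧ R) ∧ y) loop (allOf-∧ (λ i → f (suc i) zero) _) ⟩
  R ∧ (allOf (λ i → f (suc i) zero) ∧ noEdgeWithin (delete₀ a) S)
    ≡⟨ cong (λ x → R ∧ (x ∧ _)) (allOf-cong column) ⟩
  R ∧ (R ∧ noEdgeWithin (delete₀ a) S)
    ≡⟨ trans (≡.sym (BoolP.∧-assoc R R _)) (cong (_∧ _) (BoolP.∧-idem R)) ⟩
  R ∧ noEdgeWithin (delete₀ a) S
    ≡⟨ cong (R ∧_) (noEdgeWithin≡isIndep (delete₀ a) (λ u v → a-sym (suc u) (suc v)) (a-irr ∘ suc) S) ⟩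
  R ∧ isIndep (delete₀ a) S
    ≡⟨ first-row s ⟩
  isIndep a (s ∷ S) ∎
  where
  open ≡-Reasoning
  f : Fin (suc m) → Fin (suc m) → Bool
  f i j = not (lookup (s ∷ S) i ∧ lookup (s ∷ S) j ∧ a i j)
  R = allOf (λ j → f zero (suc j))
  loop : f zero zero ≡ true
  loop = trans (cong (λ b → not (s ∧ s ∧ b)) (a-irr zero)) (not-∧-false s)
    where
    not-∧-false : ∀ s → not (s ∧ s ∧ false) ≡ true
    not-∧-false true  = refl
    not-∧-false false = refl
  column : ∀ i → f (suc i) zero ≡ f zero (suc i)
  column i = trans (cong (λ b → not (lookup S i ∧ s ∧ b)) (a-sym (suc i) zero))
                   (cong not (∧.x∙yz≈y∙xz (lookup S i) s _))
  first-row : ∀ s → allOf (λ j → not (s ∧ lookup S j ∧ a zero (suc j))) ∧ isIndep (delete₀ a) S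
                  ≡ isIndep a (s ∷ S)
  first-row inside  = cong (_∧ isIndep (delete₀ a) S) (allOf-disjoint S (λ j → a zero (suc j)))
  first-row outside = cong (_∧ isIndep (delete₀ a) S) (allOf-true m)

isIndependent≡isIndep : ∀ G S → isIndependent G S ≡ isIndep (adj G) S
isIndependent≡isIndep G S = trans (allB-tabulate row (λ i → i))
  (trans (allOf-cong (λ i → allB-tabulate (entry i) (λ j → j)))
         (noEdgeWithin≡isIndep (adj G) (sym G) (irrefl G) S))
  where
  entry : Fin (n G) → Fin (n G) → Bool
  entry i j = not (lookup S i ∧ lookup S j ∧ adj G i j)
  row : Fin (n G) → Bool
  row i = allB (entry i) (L.allFin (n G))

length-filter-∷ : ∀ {A : Set} (c : A → Bool) x xs (z : ℤ) →
  + L.length (L.filter (λ y → c y Bool.≟ true) (x ∷ xs)) * z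
  ≡ (if c x then z else + 0) +ℤ + L.length (L.filter (λ y → c y Bool.≟ true) xs) * z
length-filter-∷ c x xs z with c x
... | true  = trans (ℤP.*-distribʳ-+ z (+ 1) (+ ℓ)) (cong (_+ℤ + ℓ * z) (ℤP.*-identityˡ z))
  where ℓ = L.length (L.filter (λ y → c y Bool.≟ true) xs)
... | false = ≡.sym (ℤP.+-identityˡ _)

sumOver-groupBySize : ∀ {m} (b : Subset m → Bool) N (Ss : List (Subset m)) →
  (∀ (S : Subset m) → ∣ S ∣ ℕ.< N) →
  sumOver (upTo N) (λ j → + L.length (L.filter (λ S → (b S ∧ (∣ S ∣ ≡ᵇ j)) Bool.≟ true) Ss) * sign j)
  ≡ sumOver Ss (λ S → if b S then sign ∣ S ∣ else + 0)
sumOver-groupBySize b N [] _ =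
  trans (sumOver-cong (upTo N) (λ j → ℤP.*-zeroˡ (sign j))) (sumOver-0 (upTo N))
sumOver-groupBySize {m} b N (S ∷ Ss) bound = begin
  sumOver (upTo N) (λ j → + L.length (L.filter (P? j) (S ∷ Ss)) * sign j)
    ≡⟨ sumOver-cong (upTo N) (λ j → length-filter-∷ (λ S → b S ∧ (∣ S ∣ ≡ᵇ j)) S Ss (sign j)) ⟩
  sumOver (upTo N) (λ j → (if b S ∧ (∣ S ∣ ≡ᵇ j) then sign j else + 0)
                          +ℤ + L.length (L.filter (P? j) Ss) * sign j)
    ≡⟨ sumOver-+ (upTo N) (λ j → if b S ∧ (∣ S ∣ ≡ᵇ j) then sign j else + 0)
                          (λ j → + L.length (L.filter (P? j) Ss) * sign j) ⟩
  sumOver (upTo N) (λ j → if b S ∧ (∣ S ∣ ≡ᵇ j) then sign j else + 0)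
    +ℤ sumOver (upTo N) (λ j → + L.length (L.filter (P? j) Ss) * sign j)
    ≡⟨ cong₂ _+ℤ_ (only-size (b S)) (sumOver-groupBySize b N Ss bound) ⟩
  (if b S then sign ∣ S ∣ else + 0) +ℤ sumOver Ss (λ S → if b S then sign ∣ S ∣ else + 0) ∎
  where
  open ≡-Reasoning
  P? : ∀ j (S : Subset m) → Dec ((b S ∧ (∣ S ∣ ≡ᵇ j)) ≡ true)
  P? j S = (b S ∧ (∣ S ∣ ≡ᵇ j)) Bool.≟ true
  only-size : ∀ bS → sumOver (upTo N) (λ j → if bS ∧ (∣ S ∣ ≡ᵇ j) then sign j else + 0)
                    ≡ (if bS then sign ∣ S ∣ else + 0)
  only-size true  = sumOver-delta N sign (bound S)
  only-size false = sumOver-0 (upTo N)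

indepPolyAtMinusOne≡indepSum : ∀ G → indepPolyAtMinusOne G ≡ indepSum (adj G) Subset.⊥
indepPolyAtMinusOne≡indepSum G = begin
  indepPolyAtMinusOne G
    ≡⟨ sumOver-groupBySize (isIndependent G) (suc (n G)) (allSubsets (n G)) (ℕ.s≤s ∘ ∣p∣≤n) ⟩
  sumOver (allSubsets (n G)) (λ S → if isIndependent G S then sign ∣ S ∣ else + 0)
    ≡⟨ sumOver-cong (allSubsets (n G)) (λ S → cong (λ b → if b then sign ∣ S ∣ else + 0)
                                                   (unconstrained S)) ⟩
  sumOver (allSubsets (n G)) (indepTerm (adj G) Subset.⊥)
    ≡⟨ ≡.sym (indepSum-sumOver (adj G) Subset.⊥) ⟩
  indepSum (adj G) Subset.⊥ ∎
  where
  open ≡-Reasoning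
  unconstrained : ∀ S → isIndependent G S ≡ isIndep (adj G) S ∧ disjoint S Subset.⊥
  unconstrained S = trans (isIndependent≡isIndep G S)
    (≡.sym (trans (cong (isIndep (adj G) S ∧_) (disjoint-⊥ S)) (BoolP.∧-identityʳ _)))

indepSum-cong : ∀ {m} {a b : Adjacency m} → (∀ u v → a u v ≡ b u v) → ∀ X → indepSum a X ≡ indepSum b X
indepSum-cong {zero}  a≗b []            = refl
indepSum-cong {suc m} a≗b (inside  ∷ X) = indepSum-cong (λ u v → a≗b (suc u) (suc v)) X
indepSum-cong {suc m} a≗b (outside ∷ X) = cong₂ _-_
  (indepSum-cong (λ u v → a≗b (suc u) (suc v)) X)
  (trans (cong (λ N → indepSum _ (X ∪ N)) (VecP.tabulate-cong (λ v → a≗b zero (suc v))))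
         (indepSum-cong (λ u v → a≗b (suc u) (suc v)) _))

-- Disjoint unions

sumAdjacency : ∀ {p q} → Adjacency p → Adjacency q → Fin p ⊎ Fin q → Fin p ⊎ Fin q → Bool
sumAdjacency a b (inj₁ x) (inj₁ y) = a x y
sumAdjacency a b (inj₂ x) (inj₂ y) = b x y
sumAdjacency a b (inj₁ _) (inj₂ _) = false
sumAdjacency a b (inj₂ _) (inj₁ _) = false

_⊕_ : ∀ {p q} → Adjacency p → Adjacency q → Adjacency (p + q)
_⊕_ {p} a b u v = sumAdjacency a b (Fin.splitAt p u) (Fin.splitAt p v)

unionAdj≗⊕ : ∀ G H u v → unionAdj G H u v ≡ (adj G ⊕ adj H) u v
unionAdj≗⊕ G H u v with Fin.splitAt (n G) u | Fin.splitAt (n G) v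
... | inj₁ _ | inj₁ _ = refl
... | inj₂ _ | inj₂ _ = refl
... | inj₁ _ | inj₂ _ = refl
... | inj₂ _ | inj₁ _ = refl

delete₀-⊕ : ∀ {p q} (a : Adjacency (suc p)) (b : Adjacency q) u v →
            delete₀ (a ⊕ b) u v ≡ (delete₀ a ⊕ b) u v
delete₀-⊕ {p} a b u v with Fin.splitAt p u | Fin.splitAt p v
... | inj₁ _ | inj₁ _ = refl
... | inj₂ _ | inj₂ _ = refl
... | inj₁ _ | inj₂ _ = refl
... | inj₂ _ | inj₁ _ = refl

tabulate-splitAt : ∀ {A : Set} p {q} (h : Fin p ⊎ Fin q → A) →
  tabulate (λ v → h (Fin.splitAt p v)) ≡ tabulate (h ∘ inj₁) Vec.++ tabulate (h ∘ inj₂)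
tabulate-splitAt zero    h = refl
tabulate-splitAt (suc p) h = cong (h (inj₁ zero) ∷_) (tabulate-splitAt p (λ s → h (Sum.map₁ suc s)))

neighbours₀-⊕ : ∀ {p q} (a : Adjacency (suc p)) (b : Adjacency q) →
                neighbours₀ (a ⊕ b) ≡ neighbours₀ a Vec.++ Subset.⊥
neighbours₀-⊕ {p} {q} a b =
  trans (tabulate-splitAt p (λ s → sumAdjacency a b (inj₁ zero) (Sum.map₁ suc s)))
        (cong (neighbours₀ a Vec.++_) (tabulate-false q))
  where
  tabulate-false : ∀ q → tabulate {n = q} (λ _ → false) ≡ Subset.⊥
  tabulate-false zero    = refl
  tabulate-false (suc q) = cong (false ∷_) (tabulate-false q)

indepSum-⊕ : ∀ {p q} (a : Adjacency p) (b : Adjacency q) X Y →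
             indepSum (a ⊕ b) (X Vec.++ Y) ≡ indepSum a X * indepSum b Y
indepSum-⊕ {zero} a b [] Y = ≡.sym (ℤP.*-identityˡ _)
indepSum-⊕ {suc p} a b (inside ∷ X) Y =
  trans (indepSum-cong (delete₀-⊕ a b) (X Vec.++ Y)) (indepSum-⊕ (delete₀ a) b X Y)
indepSum-⊕ {suc p} a b (outside ∷ X) Y = begin
  indepSum (delete₀ (a ⊕ b)) (X Vec.++ Y)
    - indepSum (delete₀ (a ⊕ b)) ((X Vec.++ Y) ∪ neighbours₀ (a ⊕ b))
    ≡⟨ cong₂ _-_ (indepSum-cong (delete₀-⊕ a b) _)
                 (trans (indepSum-cong (delete₀-⊕ a b) _) (cong (indepSum (delete₀ a ⊕ b)) forbidden)) ⟩
  indepSum (delete₀ a ⊕ b) (X Vec.++ Y) - indepSum (delete₀ a ⊕ b) ((X ∪ neighbours₀ a) Vec.++ Y)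
    ≡⟨ cong₂ _-_ (indepSum-⊕ (delete₀ a) b X Y) (indepSum-⊕ (delete₀ a) b (X ∪ neighbours₀ a) Y) ⟩
  indepSum (delete₀ a) X * indepSum b Y - indepSum (delete₀ a) (X ∪ neighbours₀ a) * indepSum b Y
    ≡⟨ *-distribʳ-- (indepSum (delete₀ a) X) _ (indepSum b Y) ⟩
  indepSum a (outside ∷ X) * indepSum b Y ∎
  where
  open ≡-Reasoning
  forbidden : (X Vec.++ Y) ∪ neighbours₀ (a ⊕ b) ≡ (X ∪ neighbours₀ a) Vec.++ Y
  forbidden = trans (cong ((X Vec.++ Y) ∪_) (neighbours₀-⊕ a b))
    (trans (VecP.zipWith-++ _∨_ X Y (neighbours₀ a) Subset.⊥)
           (cong ((X ∪ neighbours₀ a) Vec.++_) (∪-identityʳ Y)))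
  *-distribʳ-- : ∀ x y z → x * z - y * z ≡ (x - y) * z
  *-distribʳ-- = solve-∀

⊥-++ : ∀ p q → Subset.⊥ {p + q} ≡ Subset.⊥ {p} Vec.++ Subset.⊥ {q}
⊥-++ zero    q = refl
⊥-++ (suc p) q = cong (outside ∷_) (⊥-++ p q)

indepPolyAtMinusOne-∪ : ∀ G H →
  indepPolyAtMinusOne (disjointUnion G H) ≡ indepPolyAtMinusOne G * indepPolyAtMinusOne H
indepPolyAtMinusOne-∪ G H = begin
  indepPolyAtMinusOne (disjointUnion G H)
    ≡⟨ indepPolyAtMinusOne≡indepSum (disjointUnion G H) ⟩
  indepSum (unionAdj G H) Subset.⊥
    ≡⟨ indepSum-cong (unionAdj≗⊕ G H) _ ⟩
  indepSum (adj G ⊕ adj H) Subset.⊥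
    ≡⟨ cong (indepSum (adj G ⊕ adj H)) (⊥-++ (n G) (n H)) ⟩
  indepSum (adj G ⊕ adj H) (Subset.⊥ {n G} Vec.++ Subset.⊥)
    ≡⟨ indepSum-⊕ (adj G) (adj H) Subset.⊥ Subset.⊥ ⟩
  indepSum (adj G) Subset.⊥ * indepSum (adj H) Subset.⊥
    ≡⟨ ≡.sym (cong₂ _*_ (indepPolyAtMinusOne≡indepSum G) (indepPolyAtMinusOne≡indepSum H)) ⟩
  indepPolyAtMinusOne G * indepPolyAtMinusOne H ∎
  where open ≡-Reasoning

module _ (G H : Graph) where

  private
    onLeft : Fin (n G + n H) → Bool
    onLeft x = Sum.[ (λ _ → true) , (λ _ → false) ]′ (Fin.splitAt (n G) x)

    onLeft-adj : ∀ x y → adj (disjointUnion G H) x y ≡ true → onLeft x ≡ onLeft y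
    onLeft-adj x y e with Fin.splitAt (n G) x | Fin.splitAt (n G) y | trans (≡.sym (unionAdj≗⊕ G H x y)) e
    ... | inj₁ _ | inj₁ _ | _ = refl
    ... | inj₂ _ | inj₂ _ | _ = refl

    left-preimage : ∀ x → onLeft x ≡ true → ∃ λ u → u ↑ˡ n H ≡ x
    left-preimage x _ with Fin.splitAt (n G) x in eq
    ... | inj₁ u = u , FinP.splitAt⁻¹-↑ˡ eq

    right-preimage : ∀ x → onLeft x ≡ false → ∃ λ v → n G ↑ʳ v ≡ x
    right-preimage x _ with Fin.splitAt (n G) x in eq
    ... | inj₂ v = v , FinP.splitAt⁻¹-↑ʳ eq

    cycle-same-side : ∀ {S} (C : CycleAvoiding (disjointUnion G H) S) i →
                      onLeft (vert C i) ≡ onLeft (vert C zero)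
    cycle-same-side C = <-weakInduction (λ i → onLeft (vert C i) ≡ onLeft (vert C zero)) refl
      λ p ih → trans (≡.sym (onLeft-adj _ _ (cycle-step C p))) ih

  adj-↑ˡ : ∀ u v → adj (disjointUnion G H) (u ↑ˡ n H) (v ↑ˡ n H) ≡ adj G u v
  adj-↑ˡ u v = trans (unionAdj≗⊕ G H _ _) (cong₂ (sumAdjacency (adj G) (adj H))
    (FinP.splitAt-↑ˡ (n G) u (n H)) (FinP.splitAt-↑ˡ (n G) v (n H)))

  adj-↑ʳ : ∀ u v → adj (disjointUnion G H) (n G ↑ʳ u) (n G ↑ʳ v) ≡ adj H u v
  adj-↑ʳ u v = trans (unionAdj≗⊕ G H _ _) (cong₂ (sumAdjacency (adj G) (adj H))
    (FinP.splitAt-↑ʳ (n G) (n H) u) (FinP.splitAt-↑ʳ (n G) (n H) v))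

  cycle-one-side : ∀ {S} (C : CycleAvoiding (disjointUnion G H) S) →
    (∀ i → ∃ λ u → u ↑ˡ n H ≡ vert C i) ⊎ (∀ i → ∃ λ v → n G ↑ʳ v ≡ vert C i)
  cycle-one-side C with onLeft (vert C zero) in side₀
  ... | true  = inj₁ λ i → left-preimage  _ (trans (cycle-same-side C i) side₀)
  ... | false = inj₂ λ i → right-preimage _ (trans (cycle-same-side C i) side₀)

∣++∣ : ∀ {p q} (P : Subset p) (Q : Subset q) → ∣ P Vec.++ Q ∣ ≡ ∣ P ∣ + ∣ Q ∣
∣++∣ []            Q = refl
∣++∣ (inside  ∷ P) Q = cong suc (∣++∣ P Q)
∣++∣ (outside ∷ P) Q = ∣++∣ P Q

union-decycling : ∀ G H {k₁ k₂} → DecyclingNumberIs G k₁ → DecyclingNumberIs H k₂ →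
                  DecyclingNumberIs (disjointUnion G H) (k₁ + k₂)
union-decycling G H ((SG , SG-decycles , ∣SG∣≡k₁) , minimalG)
                    ((SH , SH-decycles , ∣SH∣≡k₂) , minimalH) =
  (SG Vec.++ SH , decycles , trans (∣++∣ SG SH) (cong₂ _+_ ∣SG∣≡k₁ ∣SH∣≡k₂)) , minimal
  where
  decycles : IsDecyclingSet (disjointUnion G H) (SG Vec.++ SH)
  decycles C with cycle-one-side G H C
  ... | inj₁ left  = SG-decycles (cycle-preimage (_↑ˡ n H)  (adj-↑ˡ G H) (VecP.lookup-++ˡ SG SH) C left)
  ... | inj₂ right = SH-decycles (cycle-preimage (n G ↑ʳ_) (adj-↑ʳ G H) (VecP.lookup-++ʳ SG SH) C right)
  minimal : ∀ S → IsDecyclingSet (disjointUnion G H) S → _ ℕ.≤ ∣ S ∣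
  minimal S S-decycles with Vec.splitAt (n G) S
  ... | TG , TH , refl = ℕP.≤-trans (ℕP.+-mono-≤ (minimalG TG TG-decycles) (minimalH TH TH-decycles))
                                    (ℕP.≤-reflexive (≡.sym (∣++∣ TG TH)))
    where
    TG-decycles : IsDecyclingSet G TG
    TG-decycles = S-decycles ∘
      cycle-image (_↑ˡ n H) (adj-↑ˡ G H) (VecP.lookup-++ˡ TG TH) (FinP.↑ˡ-injective (n H) _ _)
    TH-decycles : IsDecyclingSet H TH
    TH-decycles = S-decycles ∘
      cycle-image (n G ↑ʳ_) (adj-↑ʳ G H) (VecP.lookup-++ʳ TG TH) (FinP.↑ʳ-injective (n G) _ _)

-- Attaching a new vertex

extendAdj : ∀ {m} → Adjacency m → Subset m → Adjacency (suc m)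
extendAdj a N zero    zero    = false
extendAdj a N zero    (suc v) = lookup N v
extendAdj a N (suc u) zero    = lookup N u
extendAdj a N (suc u) (suc v) = a u v

extend : (K : Graph) → Subset (n K) → Graph
extend K N = record
  { n = suc (n K) ; adj = extendAdj (adj K) N ; sym = extend-sym ; irrefl = extend-irrefl }
  where
  extend-sym : ∀ u v → extendAdj (adj K) N u v ≡ extendAdj (adj K) N v u
  extend-sym zero    zero    = refl
  extend-sym zero    (suc v) = refl
  extend-sym (suc u) zero    = refl
  extend-sym (suc u) (suc v) = sym K u v
  extend-irrefl : ∀ v → extendAdj (adj K) N v v ≡ false
  extend-irrefl zero    = refl
  extend-irrefl (suc v) = irrefl K v

indepSum-extend : ∀ {m} (a : Adjacency m) N X →
                  indepSum (extendAdj a N) (outside ∷ X) ≡ indepSum a X - indepSum a (X ∪ N)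
indepSum-extend a N X = cong (λ N′ → indepSum a X - indepSum a (X ∪ N′)) (VecP.tabulate∘lookup N)

extend-connected : ∀ K N → (∀ u → ∃ λ r → r ∈ N × Walk K u r) → Connected (extend K N)
extend-connected K N reach-N u v = to-new u ++ᵂ reverseᵂ (to-new v)
  where
  to-new : ∀ u → Walk (extend K N) u zero
  to-new zero    = here
  to-new (suc u) with reach-N u
  ... | r , r∈N , p = mapᵂ suc (λ e → e) p ++ᵂ step (VecP.[]=⇒lookup r∈N) here

module _ (K : Graph) (N : Subset (n K)) {A : Set} (lab : Fin (n K) → A)
         (lab-adj : ∀ {u v} → adj K u v ≡ true → lab u ≡ lab v)
         (lab-inj : ∀ {u v} → u ∈ N → v ∈ N → lab u ≡ lab v → u ≡ v) where

  private
    label : Fin (suc (n K)) → Maybe A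
    label zero    = nothing
    label (suc u) = just (lab u)

    label-adj : ∀ {x y} → adj (extend K N) x y ≡ true → x ≢ zero → y ≢ zero → label x ≡ label y
    label-adj {zero}          _ x≢0 _   = ⊥-elim (x≢0 refl)
    label-adj {suc u} {zero}  _ _   y≢0 = ⊥-elim (y≢0 refl)
    label-adj {suc u} {suc v} e _   _   = cong just (lab-adj e)

    new-neighbour : ∀ {y} → adj (extend K N) zero y ≡ true → ∃ λ u → y ≡ suc u × u ∈ N
    new-neighbour {suc u} e = u , refl , VecP.lookup⇒[]= u N e

  -- Along a cycle through the new vertex, the label is constant on the remaining vertices,
  -- so the two cycle neighbours of the new vertex would be distinct members of N with equal labels.
  cycle-avoids-new : ∀ {S} (C : CycleAvoiding (extend K N) S) i → vert C i ≢ zero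
  cycle-avoids-new C i vᵢ≡0 with cycle-neighbours C i
  ... | j , k , j≢k , i~j , i~k
      with new-neighbour (≡.subst (λ x → adj (extend K N) x (vert C j) ≡ true) vᵢ≡0 i~j)
         | new-neighbour (≡.subst (λ x → adj (extend K N) x (vert C k) ≡ true) vᵢ≡0 i~k)
  ... | u , vⱼ≡u , u∈N | v , vₖ≡v , v∈N =
    j≢k (distinct C (trans vⱼ≡u (trans (cong suc (lab-inj u∈N v∈N labels)) (≡.sym vₖ≡v))))
    where
    off-i : ∀ {p} → p ≢ i → vert C p ≢ zero
    off-i p≢i e = p≢i (distinct C (trans e (≡.sym vᵢ≡0)))
    not-i : ∀ {p w} → vert C p ≡ suc w → p ≢ i
    not-i vₚ≡w refl with trans (≡.sym vₚ≡w) vᵢ≡0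
    ... | ()
    labels : lab u ≡ lab v
    labels = Maybe.just-injective (trans (cong label (≡.sym vⱼ≡u))
      (trans (cycle-constant (λ p → label (vert C p)) i
                (λ p p≢i 1+p≢i → label-adj (cycle-step C p) (off-i p≢i) (off-i 1+p≢i))
                (λ last≢i 0≢i → label-adj (close C) (off-i last≢i) (off-i 0≢i))
                j k (not-i vⱼ≡u) (not-i vₖ≡v))
             (cong label vₖ≡v)))

  extend-decycling : ∀ {k} → DecyclingNumberIs K k → DecyclingNumberIs (extend K N) k
  extend-decycling ((S , S-decycles , ∣S∣≡k) , minimal) =
    (outside ∷ S , S-decycles ∘ old-cycle , ∣S∣≡k) ,
    λ { (s ∷ S′) S′-decycles → ℕP.≤-trans (minimal S′ (S′-decycles ∘ new-cycle)) (∣p∣≤∣x∷p∣ s S′) }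
    where
    new-cycle : ∀ {s S′} → CycleAvoiding K S′ → CycleAvoiding (extend K N) (s ∷ S′)
    new-cycle = cycle-image suc (λ _ _ → refl) (λ _ → refl) FinP.suc-injective
    old-vertex : (x : Fin (suc (n K))) → x ≢ zero → ∃ λ u → suc u ≡ x
    old-vertex zero    x≢0 = ⊥-elim (x≢0 refl)
    old-vertex (suc u) _   = u , refl
    old-cycle : CycleAvoiding (extend K N) (outside ∷ S) → CycleAvoiding K S
    old-cycle C = cycle-preimage suc (λ _ _ → refl) (λ _ → refl) C
                    (λ i → old-vertex (vert C i) (cycle-avoids-new C i))

extend-⁅⁆-connected : ∀ K w → Connected K → Connected (extend K ⁅ w ⁆)
extend-⁅⁆-connected K w K-connected = extend-connected K ⁅ w ⁆ (λ u → w , x∈⁅x⁆ w , K-connected u w)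

extend-⁅⁆-decycling : ∀ K w {k} → DecyclingNumberIs K k → DecyclingNumberIs (extend K ⁅ w ⁆) k
extend-⁅⁆-decycling K w = extend-decycling K ⁅ w ⁆ (λ _ → tt) (λ _ → refl)
  (λ u∈ v∈ _ → trans (x∈⁅y⁆⇒x≡y w u∈) (≡.sym (x∈⁅y⁆⇒x≡y w v∈)))

-- K with a path w - a - b attached at w, where a and b are new.
hangPath : (K : Graph) → Fin (n K) → Graph
hangPath K w = extend (extend K ⁅ w ⁆) ⁅ zero ⁆

hangPath-connected : ∀ K w → Connected K → Connected (hangPath K w)
hangPath-connected K w = extend-⁅⁆-connected _ zero ∘ extend-⁅⁆-connected K w

hangPath-decycling : ∀ K w {k} → DecyclingNumberIs K k → DecyclingNumberIs (hangPath K w) k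
hangPath-decycling K w = extend-⁅⁆-decycling _ zero ∘ extend-⁅⁆-decycling K w

indepSum-hangPath : ∀ K w X →
  indepSum (adj (hangPath K w)) (outside ∷ outside ∷ X) ≡ - indepSum (adj K) (X ∪ ⁅ w ⁆)
indepSum-hangPath K w X = begin
  indepSum (adj (hangPath K w)) (outside ∷ outside ∷ X)
    ≡⟨ indepSum-extend (extendAdj (adj K) ⁅ w ⁆) ⁅ zero ⁆ (outside ∷ X) ⟩
  indepSum (extendAdj (adj K) ⁅ w ⁆) (outside ∷ X) - indepSum (adj K) (X ∪ Subset.⊥)
    ≡⟨ cong₂ _-_ (indepSum-extend (adj K) ⁅ w ⁆ X) (cong (indepSum (adj K)) (∪-identityʳ X)) ⟩
  (indepSum (adj K) X - indepSum (adj K) (X ∪ ⁅ w ⁆)) - indepSum (adj K) X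
    ≡⟨ cancel (indepSum (adj K) X) _ ⟩
  - indepSum (adj K) (X ∪ ⁅ w ⁆) ∎
  where
  open ≡-Reasoning
  cancel : ∀ x y → (x - y) - x ≡ - y
  cancel = solve-∀

-- Joining the components by a hub

hubGraph : Graph → Graph
hubGraph K = extend K (Components.representatives K)

hubGraph-connected : ∀ K → Connected (hubGraph K)
hubGraph-connected K =
  extend-connected K representatives (λ u → representative u , representative-∈ u , walk-to-representative u)
  where open Components K

hubGraph-decycling : ∀ K {k} → DecyclingNumberIs K k → DecyclingNumberIs (hubGraph K) k
hubGraph-decycling K = extend-decycling K representatives representative
  (λ e → representative-cong (step e here))
  (λ r∈ s∈ eq → trans (≡.sym (∈-representatives r∈)) (trans eq (∈-representatives s∈)))
  where open Components K

joinByHub : Graph → Graph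
joinByHub K = hangPath (hangPath (hubGraph K) zero) (suc (suc zero))

joinByHub-connected : ∀ K → Connected (joinByHub K)
joinByHub-connected K = hangPath-connected _ (suc (suc zero))
                          (hangPath-connected (hubGraph K) zero (hubGraph-connected K))

joinByHub-decycling : ∀ K {k} → DecyclingNumberIs K k → DecyclingNumberIs (joinByHub K) k
joinByHub-decycling K = hangPath-decycling _ (suc (suc zero))
                      ∘ hangPath-decycling (hubGraph K) zero
                      ∘ hubGraph-decycling K

-- Each pendant path contributes a factor -1 and forbids the hub.
indepPolyAtMinusOne-joinByHub : ∀ K → indepPolyAtMinusOne (joinByHub K) ≡ indepPolyAtMinusOne K
indepPolyAtMinusOne-joinByHub K = begin
  indepPolyAtMinusOne (joinByHub K)
    ≡⟨ indepPolyAtMinusOne≡indepSum (joinByHub K) ⟩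
  indepSum (adj (joinByHub K)) Subset.⊥
    ≡⟨ indepSum-hangPath (hangPath (hubGraph K) zero) (suc (suc zero)) Subset.⊥ ⟩
  - indepSum (adj (hangPath (hubGraph K) zero)) (Subset.⊥ ∪ ⁅ suc (suc zero) ⁆)
    ≡⟨ cong (λ X → - indepSum (adj (hangPath (hubGraph K) zero)) X) (∪-identityˡ ⁅ suc (suc zero) ⁆) ⟩
  - indepSum (adj (hangPath (hubGraph K) zero)) (outside ∷ outside ∷ ⁅ zero ⁆)
    ≡⟨ cong -_ (indepSum-hangPath (hubGraph K) zero ⁅ zero ⁆) ⟩
  - - indepSum (adj (hubGraph K)) (⁅ zero ⁆ ∪ ⁅ zero ⁆)
    ≡⟨ ℤP.neg-involutive _ ⟩
  indepSum (adj (hubGraph K)) (⁅ zero ⁆ ∪ ⁅ zero ⁆)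
    ≡⟨ cong (indepSum (adj (hubGraph K))) (∪-idem ⁅ zero ⁆) ⟩
  indepSum (adj K) Subset.⊥
    ≡⟨ ≡.sym (indepPolyAtMinusOne≡indepSum K) ⟩
  indepPolyAtMinusOne K ∎
  where open ≡-Reasoning

lemma2p4 : (G H : Graph) (k₁ k₂ : ℕ) (q₁ q₂ : ℤ)
    → IsKQGraph G k₁ q₁ → IsKQGraph H k₂ q₂
    → Σ Graph λ F → Connected F × IsKQGraph F (k₁ + k₂) (q₁ * q₂)
        × indepPolyAtMinusOne F ≡ indepPolyAtMinusOne (disjointUnion G H)
lemma2p4 G H k₁ k₂ q₁ q₂ (φG≡k₁ , IG≡q₁ , ∣q₁∣≤2^k₁) (φH≡k₂ , IH≡q₂ , ∣q₂∣≤2^k₂) =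
  joinByHub G∪H , joinByHub-connected G∪H ,
  (joinByHub-decycling G∪H (union-decycling G H φG≡k₁ φH≡k₂) , IF≡q₁q₂ , ∣q₁q₂∣≤2^k) ,
  indepPolyAtMinusOne-joinByHub G∪H
  where
  G∪H = disjointUnion G H
  IF≡q₁q₂ : indepPolyAtMinusOne (joinByHub G∪H) ≡ q₁ * q₂
  IF≡q₁q₂ = trans (indepPolyAtMinusOne-joinByHub G∪H)
                  (trans (indepPolyAtMinusOne-∪ G H) (cong₂ _*_ IG≡q₁ IH≡q₂))
  ∣q₁q₂∣≤2^k : ℤ.∣ q₁ * q₂ ∣ ℕ.≤ 2 ℕ.^ (k₁ + k₂)
  ∣q₁q₂∣≤2^k = subst₂ ℕ._≤_ (≡.sym (ℤP.abs-* q₁ q₂)) (≡.sym (ℕP.^-distribˡ-+-* 2 k₁ k₂))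
                           (ℕP.*-mono-≤ ∣q₁∣≤2^k₁ ∣q₂∣≤2^k₂)
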